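{- Let $\alpha,\beta$ be parameters, $n\ge1$, $x_1,\dots,x_n$ variables and $\lambda$ a partition. Then $G^{(\alpha,\beta)}_\lambda(x_1,\dots,x_n)$ equals the partition function of the following lattice model: $n$ rows with bosonic horizontal labels (nonnegative integers), row $k$ (from the bottom) having parameter $x_k$, bottom boundary all $0$, top boundary $(m^c_j(\lambda))_{j\ge1}$, right boundary value $0$, free left boundary, and vertex weights $$w_x(a,b;c,d)=\delta_{a+b,c+d}\begin{cases}\big(\frac{x}{1-\alpha x}\big)^{a}& b=c,\\ \big(\frac{x}{1-\alpha x}\big)^{a}\frac{1+\beta x}{1-\alpha x}& b>c,\\ 0& b<c.\end{cases}$$
   Context: Canonical Grothendieck polynomials. For partitions $\mu\subseteq\lambda$, $\lambda/\mu$ is a horizontal strip if $\lambda_1\ge\mu_1\ge\lambda_2\ge\mu_2\ge\cdots$. Put $\bar\lambda=(\lambda_2,\lambda_3,\dots)$; for a skew shape $\kappa/\nu$, $r(\kappa/\nu)$ is the number of $i$ with $\kappa_i>\nu_i$. The $G^{(\alpha,\beta)}_\lambda$ are determined by $G^{(\alpha,\beta)}_\lambda()=\delta_{\lambda,\emptyset}$ (no variables) and $G^{(\alpha,\beta)}_\lambda(x_1,\dots,x_{n+1})=\sum_{\mu:\lambda/\mu\text{ horizontal strip}}G^{(\alpha,\beta)}_\mu(x_1,\dots,x_n)\big(\frac{x}{1-\alpha x}\big)^{|\lambda|-|\mu|}\big(\frac{1+\beta x}{1-\alpha x}\big)^{r(\mu/\bar\lambda)}$ with $x=x_{n+1}$.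 Lattice conventions. A vertex has left label $a$, bottom label $b$, right label $c$, top label $d$. A row with parameter $x$ is a sequence of vertices at sites $j=1,2,\dots$, the right label at site $j$ being the left label at site $j+1$; vertical labels are nonnegative integers; the left label at site 1 is free (summed over all values) and the right labels must be eventually equal to the prescribed right boundary value. Rows $1,\dots,n$ are stacked bottom to top, top labels of row $k$ = bottom labels of row $k+1$; bottom labels of row 1 and top labels of row $n$ are prescribed. The partition function is the sum over all labelings of non-prescribed edges of the product of vertex weights. $m^c_j(\lambda)=\lambda_j-\lambda_{j+1}$ is the number of columns of $\lambda$ of length $j$. -}

module Defs where

open import Algebra.Bundles using (CommutativeRing)
open import Data.Nat as ℕ using (ℕ; zero; suc; _≤_; _<_; _∸_; _≟_; _<?_; _≤ᵇ_)
open import Data.List as List using (List; []; _∷_; length; map; foldr; concatMap; upTo)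
open import Data.Bool.ListAction using (and)
open import Data.List.Relation.Unary.All using (All)
open import Data.List.Relation.Unary.Linked using (Linked)
open import Data.Vec as Vec using (Vec; []; _∷_; init; last; tabulate; replicate)
open import Data.Vec.Properties using (≡-dec)
open import Data.Fin using (toℕ)
open import Data.Product using (_×_; _,_)
open import Data.Bool using (Bool; true; false; if_then_else_; _∧_)
open import Relation.Nullary using (does)

-- at la j = la_j  (1-indexed; la_j = 0 beyond the length, at la 0 = 0 unused)
at : List ℕ → ℕ → ℕ
at []       _             = 0
at (x ∷ xs) zero          = 0
at (x ∷ xs) (suc zero)    = x
at (x ∷ xs) (suc (suc j)) = at xs (suc j)

IsPartition : List ℕ → Set
IsPartition la = Linked ℕ._≥_ la × All (λ k → 0 < k) la

size : List ℕ → ℕ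
size = foldr ℕ._+_ 0

allZero : List ℕ → Bool
allZero xs = and (map (λ k → does (k ≟ 0)) xs)

idx : ℕ → List ℕ
idx L = map suc (upTo L)

lists : ℕ → ℕ → List (List ℕ)
lists zero    B = [] ∷ []
lists (suc L) B = concatMap (λ v → map (_∷ v) (upTo (suc B))) (lists L B)

-- la/mu is a horizontal strip: la_1 ≥ mu_1 ≥ la_2 ≥ mu_2 ≥ …
-- (mu a list of the same length L as la, padded with zeros; for i > L
--  the condition is automatic since then la_i = mu_i = 0)
isHStrip : List ℕ → List ℕ → Bool
isHStrip la mu = and (map (λ i → (at la (suc i) ≤ᵇ at mu i) ∧ (at mu i ≤ᵇ at la i)) (idx (length la)))

strips : List ℕ → List (List ℕ)
strips la = List.filterᵇ (isHStrip la) (lists (length la) (at la 1))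

rBar : List ℕ → List ℕ → ℕ
rBar mu la = length (List.filterᵇ (λ i → does (at la (suc i) <? at mu i)) (idx (length la)))

-- m^c_j(la) = la_j - la_{j+1}, for j = 1..N
topBoundary : (N : ℕ) → List ℕ → Vec ℕ N
topBoundary N la = tabulate (λ j → at la (suc (toℕ j)) ∸ at la (suc (suc (toℕ j))))

vecs : (N M : ℕ) → List (Vec ℕ N)
vecs zero    M = [] ∷ []
vecs (suc N) M = concatMap (λ v → map (_∷ v) (upTo (suc M))) (vecs N M)

-- Ring-valued objects.  A "variable" is a pair (x , u) where u is
-- (1 - α x)⁻¹ (this is imposed as a hypothesis in the theorem).

module Model {c ℓ} (R : CommutativeRing c ℓ) where
  open CommutativeRing R

  pow : Carrier → ℕ → Carrier
  pow a zero    = 1#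
  pow a (suc k) = a * pow a k

  Σ : List Carrier → Carrier
  Σ = foldr _+_ 0#

  module _ (α β : Carrier) where

    -- x / (1 - α x)
    y : Carrier × Carrier → Carrier
    y (x , u) = x * u

    -- (1 + β x) / (1 - α x)
    z : Carrier × Carrier → Carrier
    z (x , u) = (1# + β * x) * u

    -- canonical Grothendieck polynomial G_la(x_1,…,x_n), by the branching rule
    G : {n : ℕ} → List ℕ → Vec (Carrier × Carrier) n → Carrier
    G {zero}  la [] = if allZero la then 1# else 0#
    G {suc n} la xs =
      Σ (map (λ mu → G mu (init xs) * pow (y (last xs)) (size la ∸ size mu)
                                    * pow (z (last xs)) (rBar mu la))
             (strips la))

    w : Carrier × Carrier → ℕ → ℕ → ℕ → ℕ → Carrier
    w v a b c d =
      if does ((a ℕ.+ b) ≟ (c ℕ.+ d))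
      then (if does (b ≟ c) then pow (y v) a
            else if does (c <? b) then pow (y v) a * z v
            else 0#)
      else 0#

    -- one row (sites 1..N, all further sites have all labels 0, weight 1):
    -- left label a entering the current site, horizontal labels in {0,…,M}
    -- summed, right label after site N equal to 0.
    rowFrom : (M : ℕ) → Carrier × Carrier → ℕ → {N : ℕ} → Vec ℕ N → Vec ℕ N → Carrier
    rowFrom M v a [] [] = if does (a ≟ 0) then 1# else 0#
    rowFrom M v a (b ∷ bs) (d ∷ ds) =
      Σ (map (λ c → w v a b c d * rowFrom M v c bs ds) (upTo (suc M)))

    -- free left boundary: sum over left label a ∈ {0,…,M}
    row : (M : ℕ) → Carrier × Carrier → {N : ℕ} → Vec ℕ N → Vec ℕ N → Carrier
    row M v bs ds = Σ (map (λ a → rowFrom M v a bs ds) (upTo (suc M)))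

    -- rows stacked bottom to top (first vector entry = bottom row);
    -- interior vertical labels summed over {0,…,M}
    Z : (N M : ℕ) → Vec ℕ N → Vec ℕ N → {n : ℕ} → Vec (Carrier × Carrier) n → Carrier
    Z N M bot top [] = if does (≡-dec _≟_ bot top) then 1# else 0#
    Z N M bot top (v ∷ vs) =
      Σ (map (λ d → row M v bot d * Z N M d top vs) (vecs N M))

    -- partition function: bottom boundary 0, top boundary (m^c_j(la))_j,
    -- truncated to N columns and labels ≤ M
    PF : (N M : ℕ) → List ℕ → {n : ℕ} → Vec (Carrier × Carrier) n → Carrier
    PF N M la xs = Z N M (replicate N 0) (topBoundary N la) xs

-- Both sides obey the same recursion in the last variable.  Peeling off the top row writes the
-- partition function as Σ_d Z(d) · row(d, m^c(λ)), where Z(d) is the partition function of the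
-- remaining rows with top boundary d.  In a row with bottom labels m^c(μ) and top labels m^c(λ),
-- conservation a + b = c + d forces the horizontal label left of column j to be λ_j − μ_j; reading
-- the vertex weights column by column, such a row has nonzero weight only if λ/μ is a horizontal
-- strip, and then column j contributes (x/(1−αx))^(λ_j−μ_j), times (1+βx)/(1−αx) exactly when
-- μ_j > λ_(j+1).  This is the branching weight of G, and the labellings d of the row that carry
-- weight are exactly the m^c(μ), so induction on the number of variables ends the proof.

module Submission where

open import Defs
open import Algebra.Bundles using (CommutativeRing)
open import Data.Nat using (ℕ; suc; _≤_)
open import Data.List using (List; length)
open import Data.Vec using (Vec; lookup; zip)

import Data.Nat as ℕ
import Algebra.Solver.CommutativeMonoid
open import Data.Nat using (zero; _∸_; _<_; _≤ᵇ_; _<ᵇ_; _≡ᵇ_; _≟_; _<?_; _≤?_; z≤n; s≤s)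
import Data.Nat.Properties as ℕ
open import Data.Nat.Properties
  using (≤-refl; ≤-trans; ≤-pred; ≤-reflexive; ≤-<-trans; <-≤-trans; <-irrefl; suc-injective;
         ≰⇒>; <⇒≱; <⇒≢; <⇒≯; ≮⇒≥; ≤∧≢⇒<; +-mono-≤; +-cancelˡ-<; m≤n+m; m≤m+n; m≤n⇒∃[o]m+o≡n;
         m∸n≤m; +-∸-comm; ∸-+-assoc; +-∸-assoc; [m+n]∸[m+o]≡n∸o; m+n∸n≡m; m+n∸m≡n; m∸n+n≡m; m+[n∸m]≡n)
open import Data.List using ([]; _∷_; _++_; map; concatMap; upTo; applyUpTo; filterᵇ)
open import Data.Nat.ListAction using (sum)
open import Data.List.Properties using (map-∘; map-upTo; map-applyUpTo)
open import Data.List.Relation.Unary.Linked as Linked using (Linked; []; [-]; _∷_)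
open import Data.List.Relation.Unary.All as All using (All; []; _∷_)
import Data.List.Relation.Unary.All.Properties as All
import Data.Vec as Vec
open import Data.Vec using ([]; _∷_)
open import Data.Vec.Properties using (≡-dec; ∷-injective)
open import Data.Vec.Relation.Unary.All as VAll using ([]; _∷_)
open import Data.Bool.Properties using (∧-zeroʳ; T-≡)
open import Function.Bundles using (Equivalence)
open import Data.Bool using (Bool; true; false; if_then_else_; _∧_)
open import Data.Bool.ListAction using (and)
open import Relation.Nullary using (does; yes; no)
open import Relation.Nullary.Decidable using (dec-true; dec-false)
open import Data.Product using (_×_; _,_; proj₁; proj₂)
open import Function using (_∘_)
open import Relation.Binary.PropositionalEquality as ≡ using (_≡_; _≢_)

module Combinatorics where
  open ≡ using (refl; sym; trans; cong)

  ≤ᵇ⇒≤ : ∀ {m n} → (m ≤ᵇ n) ≡ true → m ≤ n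
  ≤ᵇ⇒≤ {m} {n} = ℕ.≤ᵇ⇒≤ m n ∘ Equivalence.from T-≡

  ∧-true : ∀ {a b} → (a ∧ b) ≡ true → a ≡ true × b ≡ true
  ∧-true {true} {true} _ = refl , refl

  map-idx : ∀ {A : Set} (f : ℕ → A) L → map f (idx L) ≡ applyUpTo (f ∘ suc) L
  map-idx f L = trans (cong (map f) (map-upTo suc L)) (map-applyUpTo suc f L)

  length-filterᵇ : ∀ {A : Set} (p : A → Bool) xs → length (filterᵇ p xs) ≡ sum (map (λ x → if p x then 1 else 0) xs)
  length-filterᵇ p [] = refl
  length-filterᵇ p (x ∷ xs) with p x
  ... | true  = cong suc (length-filterᵇ p xs)
  ... | false = length-filterᵇ p xs

  isHStrip-∷ : ∀ x la c mu → isHStrip (x ∷ la) (c ∷ mu) ≡ ((at la 1 ≤ᵇ c) ∧ (c ≤ᵇ x)) ∧ isHStrip la mu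
  isHStrip-∷ x la c mu = cong and (trans (map-idx _ (suc (length la))) (cong (_ ∷_) (sym (map-idx _ (length la)))))

  rBar-∷ : ∀ x la c mu → rBar (c ∷ mu) (x ∷ la) ≡ (if at la 1 <ᵇ c then 1 else 0) ℕ.+ rBar mu la
  rBar-∷ x la c mu = trans (count {p} (suc (length la))) (cong (_ ℕ.+_) (sym (count {p′} (length la))))
    where
    p p′ : ℕ → Bool
    p i = does (at (x ∷ la) (suc i) <? at (c ∷ mu) i)
    p′ i = does (at la (suc i) <? at mu i)
    count : ∀ {p : ℕ → Bool} L → length (filterᵇ p (idx L)) ≡ sum (applyUpTo (λ i → if p (suc i) then 1 else 0) L)
    count {p} L = trans (length-filterᵇ p (idx L)) (cong sum (map-idx _ L))

  isHStrip-∷⁻ : ∀ x la c mu → isHStrip (x ∷ la) (c ∷ mu) ≡ true → at la 1 ≤ c × c ≤ x × isHStrip la mu ≡ true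
  isHStrip-∷⁻ x la c mu h with ∧-true (trans (sym (isHStrip-∷ x la c mu)) h)
  ... | h₁₂ , h₃ with ∧-true h₁₂
  ... | h₁ , h₂ = ≤ᵇ⇒≤ h₁ , ≤ᵇ⇒≤ h₂ , h₃

  hstrip-head : ∀ la mu → length mu ≡ length la → isHStrip la mu ≡ true → at mu 1 ≤ at la 1
  hstrip-head []       []       _ _ = z≤n
  hstrip-head (x ∷ la) (c ∷ mu) _ h = proj₁ (proj₂ (isHStrip-∷⁻ x la c mu h))

  hstrip-size : ∀ la mu → length mu ≡ length la → isHStrip la mu ≡ true → size mu ≤ size la
  hstrip-size []       []       _  _ = z≤n
  hstrip-size (x ∷ la) (c ∷ mu) eq h with isHStrip-∷⁻ x la c mu h
  ... | _ , c≤x , h′ = +-mono-≤ c≤x (hstrip-size la mu (suc-injective eq) h′)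

  head-≥ : ∀ {x xs} → Linked ℕ._≥_ (x ∷ xs) → at xs 1 ≤ x
  head-≥ [-]     = z≤n
  head-≥ (p ∷ _) = p

  ∷-linked : ∀ {x xs} → at xs 1 ≤ x → Linked ℕ._≥_ xs → Linked ℕ._≥_ (x ∷ xs)
  ∷-linked {xs = []}    _ _ = [-]
  ∷-linked {xs = _ ∷ _} p l = p ∷ l

  hstrip-linked : ∀ la mu → Linked ℕ._≥_ la → length mu ≡ length la → isHStrip la mu ≡ true → Linked ℕ._≥_ mu
  hstrip-linked []       []       _ _  _ = []
  hstrip-linked (x ∷ la) (c ∷ mu) l eq h with isHStrip-∷⁻ x la c mu h
  ... | la₁≤c , _ , h′ = ∷-linked (≤-trans (hstrip-head la mu (suc-injective eq) h′) la₁≤c)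
                                  (hstrip-linked la mu (Linked.tail l) (suc-injective eq) h′)

  linked-bounded : ∀ {M la} → Linked ℕ._≥_ la → at la 1 ≤ M → All (_≤ M) la
  linked-bounded {la = []}    _ _ = []
  linked-bounded {la = _ ∷ _} l h = h ∷ linked-bounded (Linked.tail l) (≤-trans (head-≥ l) h)

  [m+n]∸[o+p]≡[m∸o]+[n∸p] : ∀ m n o p → o ≤ m → p ≤ n → (m ℕ.+ n) ∸ (o ℕ.+ p) ≡ (m ∸ o) ℕ.+ (n ∸ p)
  [m+n]∸[o+p]≡[m∸o]+[n∸p] m n o p o≤m p≤n =
    trans (sym (∸-+-assoc (m ℕ.+ n) o p)) (trans (cong (_∸ p) (+-∸-comm n o≤m)) (+-∸-assoc (m ∸ o) p≤n))

  allZero-head : ∀ la → allZero la ≡ true → at la 1 ≡ 0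
  allZero-head []      _ = refl
  allZero-head (x ∷ _) h = ℕ.≡ᵇ⇒≡ x 0 (Equivalence.from T-≡ (proj₁ (∧-true h)))

  0≡ᵇ-comm : ∀ x → (0 ≡ᵇ x) ≡ (x ≡ᵇ 0)
  0≡ᵇ-comm zero    = refl
  0≡ᵇ-comm (suc _) = refl

  topBoundary≡0⇔allZero : ∀ N la → length la ≤ N →
                          does (≡-dec _≟_ (Vec.replicate N 0) (topBoundary N la)) ≡ allZero la
  topBoundary≡0⇔allZero zero    []       _ = refl
  topBoundary≡0⇔allZero (suc N) []       _ = topBoundary≡0⇔allZero N [] z≤n
  topBoundary≡0⇔allZero (suc N) (x ∷ la) h with allZero la in eq | topBoundary≡0⇔allZero N la (≤-pred h)
  ... | true  | ih rewrite ih | allZero-head la eq = cong (_∧ true) (0≡ᵇ-comm x)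
  ... | false | ih rewrite ih = trans (∧-zeroʳ _) (sym (∧-zeroʳ _))

  topBoundary-bounded : ∀ {M} N {la} → All (_≤ M) la → VAll.All (_≤ M) (topBoundary N la)
  topBoundary-bounded zero    _ = []
  topBoundary-bounded (suc N) [] = z≤n ∷ topBoundary-bounded N []
  topBoundary-bounded (suc N) {c ∷ la} (c≤M ∷ h) = ≤-trans (m∸n≤m c (at la 1)) c≤M ∷ topBoundary-bounded N h

  zeros-bounded : ∀ N M → VAll.All (_≤ M) (Vec.replicate N 0)
  zeros-bounded zero    M = []
  zeros-bounded (suc N) M = z≤n ∷ zeros-bounded N M

  upTo-bounded : ∀ M → All (_≤ M) (upTo (suc M))
  upTo-bounded M = All.applyUpTo⁺₁ (λ i → i) (suc M) ≤-pred

  vecs-bounded : ∀ N M → All (VAll.All (_≤ M)) (vecs N M)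
  vecs-bounded zero    M = [] ∷ []
  vecs-bounded (suc N) M =
    All.concat⁺ (All.map⁺ (All.map (λ b → All.map⁺ (All.map (_∷ b) (upTo-bounded M))) (vecs-bounded N M)))

  lists-shape : ∀ L B → All (λ mu → length mu ≡ L × All (_≤ B) mu) (lists L B)
  lists-shape zero    B = (refl , []) ∷ []
  lists-shape (suc L) B =
    All.concat⁺ (All.map⁺ (All.map (λ (eq , b) → All.map⁺ (All.map (λ c≤B → cong suc eq , c≤B ∷ b) (upTo-bounded B)))
                                   (lists-shape L B)))

  suc-≤ᵇ-suc : ∀ m n → (suc m ≤ᵇ suc n) ≡ (m ≤ᵇ n)
  suc-≤ᵇ-suc zero    n = refl
  suc-≤ᵇ-suc (suc m) n = refl

  +-≤ᵇ : ∀ k m n → (k ℕ.+ m ≤ᵇ k ℕ.+ n) ≡ (m ≤ᵇ n)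
  +-≤ᵇ zero    m n = refl
  +-≤ᵇ (suc k) m n = trans (suc-≤ᵇ-suc (k ℕ.+ m) (k ℕ.+ n)) (+-≤ᵇ k m n)

  +-<ᵇ : ∀ k m n → (k ℕ.+ m <ᵇ k ℕ.+ n) ≡ (m <ᵇ n)
  +-<ᵇ zero    m n = refl
  +-<ᵇ (suc k) m n = +-<ᵇ k m n

open Combinatorics

module Sums {c ℓ} (R : CommutativeRing c ℓ) where
  open CommutativeRing R
  open Model R using (Σ; pow)
  open import Relation.Binary.Reasoning.Setoid setoid
  open import Algebra.Properties.CommutativeSemigroup +-commutativeSemigroup using ()
    renaming (interchange to +-interchange)

  ind : Bool → Carrier
  ind b = if b then 1# else 0#

  ind-∧ : ∀ p q → ind (p ∧ q) ≈ ind p * ind q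
  ind-∧ true  _ = sym (*-identityˡ _)
  ind-∧ false _ = sym (zeroˡ _)

  ind-true : ∀ {b} a → b ≡ true → ind b * a ≈ a
  ind-true a ≡.refl = *-identityˡ a

  ind-false : ∀ {b} a → b ≡ false → ind b * a ≈ 0#
  ind-false a ≡.refl = zeroˡ a

  module _ {A : Set} where
    Σ-cong : ∀ {f g : A → Carrier} xs → (∀ x → f x ≈ g x) → Σ (map f xs) ≈ Σ (map g xs)
    Σ-cong []       _   = refl
    Σ-cong (x ∷ xs) f≈g = +-cong (f≈g x) (Σ-cong xs f≈g)

    Σ-cong-All : ∀ {P : A → Set} {f g : A → Carrier} {xs} → All P xs → (∀ {x} → P x → f x ≈ g x) →
                 Σ (map f xs) ≈ Σ (map g xs)
    Σ-cong-All []       _   = refl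
    Σ-cong-All (p ∷ ps) f≈g = +-cong (f≈g p) (Σ-cong-All ps f≈g)

    Σ-zero : ∀ {f : A → Carrier} xs → (∀ x → f x ≈ 0#) → Σ (map f xs) ≈ 0#
    Σ-zero []       _  = refl
    Σ-zero (x ∷ xs) f≈0 = trans (+-cong (f≈0 x) (Σ-zero xs f≈0)) (+-identityˡ 0#)

    Σ-+ : ∀ (f g : A → Carrier) xs → Σ (map (λ x → f x + g x) xs) ≈ Σ (map f xs) + Σ (map g xs)
    Σ-+ f g []       = sym (+-identityˡ 0#)
    Σ-+ f g (x ∷ xs) = trans (+-congˡ (Σ-+ f g xs)) (+-interchange (f x) (g x) _ _)

    *-Σ : ∀ a (f : A → Carrier) xs → a * Σ (map f xs) ≈ Σ (map (λ x → a * f x) xs)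
    *-Σ a f []       = zeroʳ a
    *-Σ a f (x ∷ xs) = trans (distribˡ a (f x) _) (+-congˡ (*-Σ a f xs))

    Σ-* : ∀ a (f : A → Carrier) xs → Σ (map f xs) * a ≈ Σ (map (λ x → f x * a) xs)
    Σ-* a f []       = zeroˡ a
    Σ-* a f (x ∷ xs) = trans (distribʳ a (f x) _) (+-congˡ (Σ-* a f xs))

    Σ-++ : ∀ (f : A → Carrier) xs ys → Σ (map f (xs ++ ys)) ≈ Σ (map f xs) + Σ (map f ys)
    Σ-++ f []       ys = sym (+-identityˡ _)
    Σ-++ f (x ∷ xs) ys = trans (+-congˡ (Σ-++ f xs ys)) (sym (+-assoc _ _ _))

    Σ-filterᵇ : ∀ (p : A → Bool) (f : A → Carrier) xs →
                Σ (map f (filterᵇ p xs)) ≈ Σ (map (λ x → ind (p x) * f x) xs)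
    Σ-filterᵇ p f []       = refl
    Σ-filterᵇ p f (x ∷ xs) with p x
    ... | true  = +-cong (sym (*-identityˡ _)) (Σ-filterᵇ p f xs)
    ... | false = trans (Σ-filterᵇ p f xs) (sym (trans (+-congʳ (zeroˡ _)) (+-identityˡ _)))

  module _ {A B : Set} where
    Σ-map : ∀ (f : B → Carrier) (g : A → B) xs → Σ (map f (map g xs)) ≈ Σ (map (f ∘ g) xs)
    Σ-map f g xs = reflexive (≡.cong Σ (≡.sym (map-∘ xs)))

    Σ-concatMap : ∀ (f : B → Carrier) (g : A → List B) xs →
                  Σ (map f (concatMap g xs)) ≈ Σ (map (λ x → Σ (map f (g x))) xs)
    Σ-concatMap f g []       = refl
    Σ-concatMap f g (x ∷ xs) = trans (Σ-++ f (g x) _) (+-congˡ (Σ-concatMap f g xs))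

    Σ-swap : ∀ (f : A → B → Carrier) xs ys →
             Σ (map (λ x → Σ (map (f x) ys)) xs) ≈ Σ (map (λ y → Σ (map (λ x → f x y) xs)) ys)
    Σ-swap f []       ys = sym (Σ-zero ys (λ _ → refl))
    Σ-swap f (x ∷ xs) ys = trans (+-congˡ (Σ-swap f xs ys)) (sym (Σ-+ (f x) (λ y → Σ (map (λ x → f x y) xs)) ys))

  pow-+ : ∀ a m n → pow a (m ℕ.+ n) ≈ pow a m * pow a n
  pow-+ a zero    n = sym (*-identityˡ _)
  pow-+ a (suc m) n = trans (*-congˡ (pow-+ a m n)) (sym (*-assoc _ _ _))

  Σ-upTo-suc : ∀ (f : ℕ → Carrier) n → Σ (map f (upTo (suc n))) ≈ f 0 + Σ (map (f ∘ suc) (upTo n))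
  Σ-upTo-suc f n = +-congˡ (trans (reflexive (≡.cong (Σ ∘ map f) (≡.sym (map-upTo suc n)))) (Σ-map f suc (upTo n)))

  Σ-upTo-δ : ∀ n c₀ (f : ℕ → Carrier) → (∀ c → c ≢ c₀ → f c ≈ 0#) →
             Σ (map f (upTo n)) ≈ ind (c₀ <ᵇ n) * f c₀
  Σ-upTo-δ zero    c₀       f f≈0 = sym (zeroˡ _)
  Σ-upTo-δ (suc n) zero     f f≈0 = begin
    Σ (map f (upTo (suc n)))           ≈⟨ Σ-upTo-suc f n ⟩
    f 0 + Σ (map (f ∘ suc) (upTo n))   ≈⟨ +-congˡ (Σ-zero (upTo n) (λ c → f≈0 (suc c) λ ())) ⟩
    f 0 + 0#                           ≈⟨ +-identityʳ _ ⟩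
    f 0                                ≈⟨ sym (*-identityˡ _) ⟩
    1# * f 0                           ∎
  Σ-upTo-δ (suc n) (suc c₀) f f≈0 = begin
    Σ (map f (upTo (suc n)))           ≈⟨ Σ-upTo-suc f n ⟩
    f 0 + Σ (map (f ∘ suc) (upTo n))   ≈⟨ +-cong (f≈0 0 λ ())
                                                   (Σ-upTo-δ n c₀ (f ∘ suc) λ c c≢ → f≈0 (suc c) (c≢ ∘ suc-injective)) ⟩
    0# + ind (c₀ <ᵇ n) * f (suc c₀)    ≈⟨ +-identityˡ _ ⟩
    ind (c₀ <ᵇ n) * f (suc c₀)         ∎

  Σ-upTo-single : ∀ {n c₀} (f : ℕ → Carrier) → c₀ < n → (∀ c → c ≢ c₀ → f c ≈ 0#) →
                  Σ (map f (upTo n)) ≈ f c₀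
  Σ-upTo-single {n} {c₀} f c₀<n f≈0 = trans (Σ-upTo-δ n c₀ f f≈0) (ind-true _ (dec-true (c₀ <? n) c₀<n))

  Σ-vecs-single : ∀ {N M} {e : Vec ℕ N} (f : Vec ℕ N → Carrier) → VAll.All (_≤ M) e →
                  (∀ d → d ≢ e → f d ≈ 0#) → Σ (map f (vecs N M)) ≈ f e
  Σ-vecs-single {zero}  {M} {[]}     f []         f≈0 = +-identityʳ _
  Σ-vecs-single {suc N} {M} {e ∷ es} f (e≤M ∷ es≤M) f≈0 = begin
    Σ (map f (vecs (suc N) M))
      ≈⟨ Σ-concatMap f (λ ds → map (_∷ ds) (upTo (suc M))) (vecs N M) ⟩
    Σ (map (λ ds → Σ (map f (map (_∷ ds) (upTo (suc M))))) (vecs N M))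
      ≈⟨ Σ-cong (vecs N M) (λ ds → Σ-map f (_∷ ds) (upTo (suc M))) ⟩
    Σ (map (λ ds → Σ (map (λ d → f (d ∷ ds)) (upTo (suc M)))) (vecs N M))
      ≈⟨ Σ-vecs-single _ es≤M (λ ds ds≢ →
           Σ-zero (upTo (suc M)) λ d → f≈0 (d ∷ ds) (ds≢ ∘ proj₂ ∘ ∷-injective)) ⟩
    Σ (map (λ d → f (d ∷ es)) (upTo (suc M)))
      ≈⟨ Σ-upTo-single (λ d → f (d ∷ es)) (s≤s e≤M) (λ d d≢ →
           f≈0 (d ∷ es) (d≢ ∘ proj₁ ∘ ∷-injective)) ⟩
    f (e ∷ es) ∎

  δᵛ : ∀ {N} → Vec ℕ N → Vec ℕ N → Carrier
  δᵛ d e = ind (does (≡-dec _≟_ d e))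

  δᵛ-refl : ∀ {N} (d : Vec ℕ N) → δᵛ d d ≈ 1#
  δᵛ-refl d = reflexive (≡.cong ind (dec-true (≡-dec _≟_ d d) ≡.refl))

  δᵛ-≢ : ∀ {N} {d e : Vec ℕ N} → d ≢ e → δᵛ d e ≈ 0#
  δᵛ-≢ {d = d} {e} d≢e = reflexive (≡.cong ind (dec-false (≡-dec _≟_ d e) d≢e))

  Σ-fibres : ∀ {A : Set} {N} M (h : A → Vec ℕ N) (f : Vec ℕ N → Carrier) (g : A → Carrier) {xs} →
             All (λ x → VAll.All (_≤ M) (h x)) xs →
             Σ (map (λ x → f (h x) * g x) xs) ≈ Σ (map (λ d → f d * Σ (map (λ x → δᵛ d (h x) * g x) xs)) (vecs N M))
  Σ-fibres {N = N} M h f g {xs} bounded = begin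
    Σ (map (λ x → f (h x) * g x) xs)
      ≈⟨ Σ-cong-All bounded (λ {x} hx≤M → sym (fibre x hx≤M)) ⟩
    Σ (map (λ x → Σ (map (λ d → f d * (δᵛ d (h x) * g x)) (vecs N M))) xs)
      ≈⟨ Σ-swap (λ x d → f d * (δᵛ d (h x) * g x)) xs (vecs N M) ⟩
    Σ (map (λ d → Σ (map (λ x → f d * (δᵛ d (h x) * g x)) xs)) (vecs N M))
      ≈⟨ Σ-cong (vecs N M) (λ d → sym (*-Σ (f d) _ xs)) ⟩
    Σ (map (λ d → f d * Σ (map (λ x → δᵛ d (h x) * g x) xs)) (vecs N M)) ∎
    where
    fibre : ∀ x → VAll.All (_≤ M) (h x) → Σ (map (λ d → f d * (δᵛ d (h x) * g x)) (vecs N M)) ≈ f (h x) * g x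
    fibre x hx≤M = trans
      (Σ-vecs-single (λ d → f d * (δᵛ d (h x) * g x)) hx≤M
                     (λ d d≢ → trans (*-congˡ (trans (*-congʳ (δᵛ-≢ d≢)) (zeroˡ _))) (zeroʳ _)))
      (*-congˡ (trans (*-congʳ (δᵛ-refl (h x))) (*-identityˡ _)))

module Lattice {c ℓ} (R : CommutativeRing c ℓ) (α β : CommutativeRing.Carrier R) where
  open CommutativeRing R
  open Model R
  open Sums R
  open import Relation.Binary.Reasoning.Setoid setoid
  open import Algebra.Properties.CommutativeSemigroup *-commutativeSemigroup using (interchange)
  module CM = Algebra.Solver.CommutativeMonoid *-commutativeMonoid

  module Weights (v : Carrier × Carrier) where
    zIf : Bool → Carrier
    zIf b = if b then z α β v else 1#

    -- The factor of column i in the branching weight of λ/μ, as a function of λ_(i+1), μ_i, λ_i.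
    columnWeight : ℕ → ℕ → ℕ → Carrier
    columnWeight l′ m l = ind ((l′ ≤ᵇ m) ∧ (m ≤ᵇ l)) * (pow (y α β v) (l ∸ m) * zIf (l′ <ᵇ m))

    stripWeight : List ℕ → List ℕ → Carrier
    stripWeight []       []       = 1#
    stripWeight (m ∷ mu) (l ∷ la) = columnWeight (at la 1) m l * stripWeight mu la
    stripWeight _        _        = 0#

    pow-zIf : ∀ b → pow (z α β v) (if b then 1 else 0) ≈ zIf b
    pow-zIf true  = *-identityʳ _
    pow-zIf false = refl

    hstrip-weight : ∀ la mu → length mu ≡ length la →
      ind (isHStrip la mu) * (pow (y α β v) (size la ∸ size mu) * pow (z α β v) (rBar mu la)) ≈ stripWeight mu la
    hstrip-weight []       []       _  = trans (*-identityˡ _) (*-identityˡ _)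
    hstrip-weight (x ∷ la) (c ∷ mu) eq = trans (reflexive (≡.cong (λ b → ind b * powers) (isHStrip-∷ x la c mu))) by-cases
      where
      Y^ Z^ : ℕ → Carrier
      Y^ = pow (y α β v)
      Z^ = pow (z α β v)
      powers : Carrier
      powers = Y^ ((x ℕ.+ size la) ∸ (c ℕ.+ size mu)) * Z^ (rBar (c ∷ mu) (x ∷ la))
      by-cases : ind (((at la 1 ≤ᵇ c) ∧ (c ≤ᵇ x)) ∧ isHStrip la mu) * powers
                 ≈ columnWeight (at la 1) c x * stripWeight mu la
      by-cases with (at la 1 ≤ᵇ c) ∧ (c ≤ᵇ x) in h₁ | isHStrip la mu in h₂ | hstrip-weight la mu (suc-injective eq)
      ... | false | _     | _  = trans (zeroˡ _) (sym (trans (*-congʳ (zeroˡ _)) (zeroˡ _)))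
      ... | true  | false | ih = trans (zeroˡ _) (sym (trans (*-congˡ (trans (sym ih) (zeroˡ _))) (zeroʳ _)))
      ... | true  | true  | ih = begin
        1# * powers
          ≈⟨ *-identityˡ _ ⟩
        Y^ ((x ℕ.+ size la) ∸ (c ℕ.+ size mu)) * Z^ (rBar (c ∷ mu) (x ∷ la))
          ≡⟨ ≡.cong₂ (λ m n → Y^ m * Z^ n)
                     ([m+n]∸[o+p]≡[m∸o]+[n∸p] x (size la) c (size mu) c≤x (hstrip-size la mu (suc-injective eq) h₂))
                     (rBar-∷ x la c mu) ⟩
        Y^ ((x ∸ c) ℕ.+ (size la ∸ size mu)) * Z^ ((if at la 1 <ᵇ c then 1 else 0) ℕ.+ rBar mu la)
          ≈⟨ *-cong (pow-+ _ (x ∸ c) _) (trans (pow-+ _ (if at la 1 <ᵇ c then 1 else 0) _) (*-congʳ (pow-zIf _))) ⟩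
        (Y^ (x ∸ c) * Y^ (size la ∸ size mu)) * (zIf (at la 1 <ᵇ c) * Z^ (rBar mu la))
          ≈⟨ interchange _ _ _ _ ⟩
        (Y^ (x ∸ c) * zIf (at la 1 <ᵇ c)) * (Y^ (size la ∸ size mu) * Z^ (rBar mu la))
          ≈⟨ *-cong (sym (*-identityˡ _)) (trans (sym (*-identityˡ _)) ih) ⟩
        1# * (Y^ (x ∸ c) * zIf (at la 1 <ᵇ c)) * stripWeight mu la ∎
        where
        c≤x : c ≤ x
        c≤x = ≤ᵇ⇒≤ (proj₂ (∧-true h₁))

    columnWeight-+ : ∀ k l′ m l → columnWeight (k ℕ.+ l′) (k ℕ.+ m) (k ℕ.+ l) ≡ columnWeight l′ m l
    columnWeight-+ k l′ m l rewrite +-≤ᵇ k l′ m | +-≤ᵇ k m l | +-<ᵇ k l′ m | [m+n]∸[m+o]≡n∸o k l m = ≡.refl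

    columnWeight-below : ∀ {l′ m l} → m < l′ → columnWeight l′ m l ≈ 0#
    columnWeight-below {l′} {m} m<l′ = ind-false _ (≡.cong (_∧ _) (dec-false (l′ ≤? m) (<⇒≱ m<l′)))

    columnWeight-above : ∀ {l′ m l} → l < m → columnWeight l′ m l ≈ 0#
    columnWeight-above {m = m} {l} l<m =
      ind-false _ (≡.trans (≡.cong (_ ∧_) (dec-false (m ≤? l) (<⇒≱ l<m))) (∧-zeroʳ _))

    stripWeight-above : ∀ mu la → at la 1 < at mu 1 → stripWeight mu la ≈ 0#
    stripWeight-above []       []       ()
    stripWeight-above []       (_ ∷ _)  _   = refl
    stripWeight-above (_ ∷ _)  []       _   = refl
    stripWeight-above (m ∷ mu) (l ∷ la) l<m = trans (*-congʳ (columnWeight-above l<m)) (zeroˡ _)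

    w-zeros : ∀ a b → w α β v a b 0 0 ≈ ind (a ≡ᵇ 0) * ind (b ≡ᵇ 0)
    w-zeros zero    zero    = sym (*-identityˡ _)
    w-zeros zero    (suc b) = sym (zeroʳ _)
    w-zeros (suc a) b       = sym (zeroˡ _)

    w-off : ∀ a b c d → a ℕ.+ b ≢ c ℕ.+ d → w α β v a b c d ≈ 0#
    w-off a b c d a+b≢c+d rewrite dec-false (a ℕ.+ b ≟ c ℕ.+ d) a+b≢c+d = refl

    w-below : ∀ a b c d → b < c → w α β v a b c d ≈ 0#
    w-below a b c d b<c rewrite dec-false (b ≟ c) (<⇒≢ b<c) | dec-false (c <? b) (<⇒≯ b<c) with a ℕ.+ b ≡ᵇ c ℕ.+ d
    ... | true  = refl
    ... | false = refl

    w-on : ∀ a b c d → a ℕ.+ b ≡ c ℕ.+ d → c ≤ b → w α β v a b c d ≈ pow (y α β v) a * zIf (c <ᵇ b)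
    w-on a b c d a+b≡c+d c≤b rewrite dec-true (a ℕ.+ b ≟ c ℕ.+ d) a+b≡c+d with b ≟ c
    ... | yes ≡.refl rewrite dec-true (b ≟ b) ≡.refl | dec-false (b <? b) (<-irrefl ≡.refl) = sym (*-identityʳ _)
    ... | no b≢c rewrite dec-false (b ≟ c) b≢c | dec-true (c <? b) (≤∧≢⇒< c≤b (b≢c ∘ ≡.sym)) = refl

    w≈columnWeight : ∀ a b c d → w α β v a b c d ≈ ind (a ≡ᵇ (c ℕ.+ d) ∸ b) * columnWeight c b (c ℕ.+ d)
    w≈columnWeight a b c d with b <? c | c ℕ.+ d <? b
    ... | yes b<c | _ = trans (w-below a b c d b<c) (sym (trans (*-congˡ (columnWeight-below b<c)) (zeroʳ _)))
    ... | no _ | yes c+d<b = trans (w-off a b c d a+b≢c+d) (sym (trans (*-congˡ (columnWeight-above c+d<b)) (zeroʳ _)))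
      where
      a+b≢c+d : a ℕ.+ b ≢ c ℕ.+ d
      a+b≢c+d eq = <⇒≱ c+d<b (≤-trans (m≤n+m b a) (≤-reflexive eq))
    ... | no b≮c | no c+d≮b with a ≟ (c ℕ.+ d) ∸ b
    ...   | no a≢ = trans (w-off a b c d (a≢ ∘ a≡)) (sym (ind-false _ (dec-false (a ≟ (c ℕ.+ d) ∸ b) a≢)))
      where
      a≡ : a ℕ.+ b ≡ c ℕ.+ d → a ≡ (c ℕ.+ d) ∸ b
      a≡ eq = ≡.trans (≡.sym (m+n∸n≡m a b)) (≡.cong (_∸ b) eq)
    ...   | yes ≡.refl = begin
      w α β v ((c ℕ.+ d) ∸ b) b c d                   ≈⟨ w-on _ b c d (m∸n+n≡m (≮⇒≥ c+d≮b)) (≮⇒≥ b≮c) ⟩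
      pow (y α β v) ((c ℕ.+ d) ∸ b) * zIf (c <ᵇ b)    ≈⟨ sym (ind-true _ in-column) ⟩
      columnWeight c b (c ℕ.+ d)                      ≈⟨ sym (ind-true _ (dec-true (_ ≟ (c ℕ.+ d) ∸ b) ≡.refl)) ⟩
      ind (((c ℕ.+ d) ∸ b) ≡ᵇ (c ℕ.+ d) ∸ b) * columnWeight c b (c ℕ.+ d) ∎
      where
      in-column : ((c ≤ᵇ b) ∧ (b ≤ᵇ c ℕ.+ d)) ≡ true
      in-column = ≡.cong₂ _∧_ (dec-true (c ≤? b) (≮⇒≥ b≮c)) (dec-true (b ≤? c ℕ.+ d) (≮⇒≥ c+d≮b))

    -- With l = λ₁, l′ = λ₂, w₁ = μ₂ and c = μ₁: the vertex weight w(a, d₁; λ₂ − μ₂, λ₁ − λ₂) is the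
    -- column weight of the unique μ₁ with d₁ = μ₁ − μ₂, provided a = λ₁ − μ₁.
    Σ-column≈w : ∀ a d₁ w₁ l′ l B → w₁ ≤ l′ → l′ ≤ l → l ≤ B →
      Σ (map (λ c → ind (a ≡ᵇ l ∸ c) * (ind (d₁ ≡ᵇ c ∸ w₁) * columnWeight l′ c l)) (upTo (suc B)))
        ≈ w α β v a d₁ (l′ ∸ w₁) (l ∸ l′)
    Σ-column≈w a d₁ w₁ _ _ B w₁≤l′ l′≤l l≤B with m≤n⇒∃[o]m+o≡n w₁≤l′ | m≤n⇒∃[o]m+o≡n l′≤l
    ... | p , ≡.refl | q , ≡.refl rewrite m+n∸m≡n w₁ p | m+n∸m≡n (w₁ ℕ.+ p) q | ℕ.+-assoc w₁ p q = begin
      Σ (map column (upTo (suc B)))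
        ≈⟨ Σ-upTo-δ (suc B) (w₁ ℕ.+ d₁) column off-diagonal ⟩
      ind (w₁ ℕ.+ d₁ <ᵇ suc B) * column (w₁ ℕ.+ d₁)
        ≈⟨ *-congˡ on-diagonal ⟩
      ind (w₁ ℕ.+ d₁ <ᵇ suc B) * (ind (a ≡ᵇ (p ℕ.+ q) ∸ d₁) * columnWeight p d₁ (p ℕ.+ q))
        ≈⟨ *-congˡ (sym (w≈columnWeight a d₁ p q)) ⟩
      ind (w₁ ℕ.+ d₁ <ᵇ suc B) * w α β v a d₁ p q
        ≈⟨ in-range ⟩
      w α β v a d₁ p q ∎
      where
      column : ℕ → Carrier
      column c = ind (a ≡ᵇ w₁ ℕ.+ (p ℕ.+ q) ∸ c)
               * (ind (d₁ ≡ᵇ c ∸ w₁) * columnWeight (w₁ ℕ.+ p) c (w₁ ℕ.+ (p ℕ.+ q)))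

      off-diagonal : ∀ c → c ≢ w₁ ℕ.+ d₁ → column c ≈ 0#
      off-diagonal c c≢ with d₁ ≟ c ∸ w₁
      ... | no d₁≢ = trans (*-congˡ (ind-false _ (dec-false (d₁ ≟ c ∸ w₁) d₁≢))) (zeroʳ _)
      ... | yes d₁≡ =
        trans (*-congˡ (trans (*-congˡ (columnWeight-below (<-≤-trans c<w₁ (m≤m+n w₁ p)))) (zeroʳ _))) (zeroʳ _)
        where
        c<w₁ : c < w₁
        c<w₁ = ≰⇒> λ w₁≤c → c≢ (≡.trans (≡.sym (m+[n∸m]≡n w₁≤c)) (≡.cong (w₁ ℕ.+_) (≡.sym d₁≡)))

      on-diagonal : column (w₁ ℕ.+ d₁) ≈ ind (a ≡ᵇ (p ℕ.+ q) ∸ d₁) * columnWeight p d₁ (p ℕ.+ q)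
      on-diagonal = begin
        column (w₁ ℕ.+ d₁)
          ≡⟨ ≡.cong₂ (λ s t → ind (a ≡ᵇ s) * (ind (d₁ ≡ᵇ t) * columnWeight (w₁ ℕ.+ p) (w₁ ℕ.+ d₁) (w₁ ℕ.+ (p ℕ.+ q))))
                     ([m+n]∸[m+o]≡n∸o w₁ (p ℕ.+ q) d₁) (m+n∸m≡n w₁ d₁) ⟩
        ind (a ≡ᵇ (p ℕ.+ q) ∸ d₁) * (ind (d₁ ≡ᵇ d₁) * columnWeight (w₁ ℕ.+ p) (w₁ ℕ.+ d₁) (w₁ ℕ.+ (p ℕ.+ q)))
          ≈⟨ *-congˡ (ind-true _ (dec-true (d₁ ≟ d₁) ≡.refl)) ⟩
        ind (a ≡ᵇ (p ℕ.+ q) ∸ d₁) * columnWeight (w₁ ℕ.+ p) (w₁ ℕ.+ d₁) (w₁ ℕ.+ (p ℕ.+ q))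
          ≡⟨ ≡.cong (ind (a ≡ᵇ (p ℕ.+ q) ∸ d₁) *_) (columnWeight-+ w₁ p d₁ (p ℕ.+ q)) ⟩
        ind (a ≡ᵇ (p ℕ.+ q) ∸ d₁) * columnWeight p d₁ (p ℕ.+ q) ∎

      in-range : ind (w₁ ℕ.+ d₁ <ᵇ suc B) * w α β v a d₁ p q ≈ w α β v a d₁ p q
      in-range with w₁ ℕ.+ d₁ <? suc B
      ... | yes in-B = ind-true _ (dec-true (w₁ ℕ.+ d₁ <? suc B) in-B)
      ... | no ¬in-B = trans (ind-false _ (dec-false (w₁ ℕ.+ d₁ <? suc B) ¬in-B))
                             (sym (trans (w≈columnWeight a d₁ p q) (trans (*-congˡ (columnWeight-above p+q<d₁)) (zeroʳ _))))
        where
        p+q<d₁ : p ℕ.+ q < d₁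
        p+q<d₁ = +-cancelˡ-< w₁ (p ℕ.+ q) d₁ (≤-<-trans l≤B (≮⇒≥ ¬in-B))

  module RowTransfer (M : ℕ) (v : Carrier × Carrier) where
    open Weights v

    rowFrom-zeros : ∀ N a (d : Vec ℕ N) →
                    rowFrom α β M v a d (topBoundary N []) ≈ ind (a ≡ᵇ 0) * δᵛ d (topBoundary N [])
    rowFrom-zeros zero    a []       = sym (*-identityʳ _)
    rowFrom-zeros (suc N) a (b ∷ bs) = begin
      Σ (map (λ c → w α β v a b c 0 * rowFrom α β M v c bs zeros) (upTo (suc M)))
        ≈⟨ Σ-upTo-single {suc M} (λ c → w α β v a b c 0 * rowFrom α β M v c bs zeros) (s≤s z≤n) (λ c c≢0 →
             trans (*-congˡ (trans (rowFrom-zeros N c bs) (ind-false _ (dec-false (c ≟ 0) c≢0)))) (zeroʳ _)) ⟩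
      w α β v a b 0 0 * rowFrom α β M v 0 bs zeros
        ≈⟨ *-cong (w-zeros a b) (trans (rowFrom-zeros N 0 bs) (*-identityˡ _)) ⟩
      (ind (a ≡ᵇ 0) * ind (b ≡ᵇ 0)) * δᵛ bs zeros
        ≈⟨ trans (*-assoc _ _ _) (*-congˡ (sym (ind-∧ _ _))) ⟩
      ind (a ≡ᵇ 0) * δᵛ (b ∷ bs) (0 ∷ zeros) ∎
      where
      zeros : Vec ℕ N
      zeros = topBoundary N []

    rowTerm : ∀ {N} → ℕ → Vec ℕ N → List ℕ → List ℕ → Carrier
    rowTerm {N} a d la mu = ind (a ≡ᵇ at la 1 ∸ at mu 1) * (δᵛ d (topBoundary N mu) * stripWeight mu la)

    rowTerm-∷ : ∀ {N} a d₁ (ds : Vec ℕ N) x la mu B → at la 1 ≤ x → x ≤ M → x ≤ B →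
      Σ (map (λ c → w α β v a d₁ c (x ∸ at la 1) * rowTerm c ds la mu) (upTo (suc M)))
        ≈ Σ (map (λ c → rowTerm a (d₁ ∷ ds) (x ∷ la) (c ∷ mu)) (upTo (suc B)))
    rowTerm-∷ {N} a d₁ ds x la mu B la₁≤x x≤M x≤B = begin
      Σ (map (λ c → W c * rowTerm c ds la mu) (upTo (suc M)))
        ≈⟨ Σ-upTo-single (λ c → W c * rowTerm c ds la mu) (s≤s (≤-trans (m∸n≤m (at la 1) (at mu 1)) la₁≤M))
             (λ c c≢ → trans (*-congˡ (ind-false _ (dec-false (c ≟ c₀) c≢))) (zeroʳ _)) ⟩
      W c₀ * (ind (c₀ ≡ᵇ c₀) * tailWeight)
        ≈⟨ *-congˡ (ind-true _ (dec-true (c₀ ≟ c₀) ≡.refl)) ⟩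
      W c₀ * tailWeight
        ≈⟨ pull-out-tail ⟩
      tailWeight * Σ (map column (upTo (suc B)))
        ≈⟨ *-Σ tailWeight column (upTo (suc B)) ⟩
      Σ (map (λ c → tailWeight * column c) (upTo (suc B)))
        ≈⟨ Σ-cong (upTo (suc B)) (λ c → sym (regroup _ _ _ (columnWeight (at la 1) c x) (stripWeight mu la))) ⟩
      Σ (map (λ c → rowTerm a (d₁ ∷ ds) (x ∷ la) (c ∷ mu)) (upTo (suc B))) ∎
      where
      la₁≤M : at la 1 ≤ M
      la₁≤M = ≤-trans la₁≤x x≤M
      W : ℕ → Carrier
      W c = w α β v a d₁ c (x ∸ at la 1)
      c₀ : ℕ
      c₀ = at la 1 ∸ at mu 1
      tailWeight : Carrier
      tailWeight = δᵛ ds (topBoundary N mu) * stripWeight mu la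
      column : ℕ → Carrier
      column c = ind (a ≡ᵇ x ∸ c) * (ind (d₁ ≡ᵇ c ∸ at mu 1) * columnWeight (at la 1) c x)

      pull-out-tail : W c₀ * tailWeight ≈ tailWeight * Σ (map column (upTo (suc B)))
      pull-out-tail with at mu 1 ≤? at la 1
      ... | yes mu₁≤la₁ =
        trans (*-comm _ _) (*-congˡ (sym (Σ-column≈w a d₁ (at mu 1) (at la 1) x B mu₁≤la₁ la₁≤x x≤B)))
      ... | no  mu₁≰la₁ = trans (*-congˡ tail≈0) (trans (zeroʳ _) (sym (trans (*-congʳ tail≈0) (zeroˡ _))))
        where
        tail≈0 : tailWeight ≈ 0#
        tail≈0 = trans (*-congˡ (stripWeight-above mu la (≰⇒> mu₁≰la₁))) (zeroʳ _)

      regroup : ∀ p q r (C S : Carrier) → ind p * (ind (q ∧ r) * (C * S)) ≈ (ind r * S) * (ind p * (ind q * C))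
      regroup p q r C S = begin
        ind p * (ind (q ∧ r) * (C * S))        ≈⟨ *-congˡ (*-congʳ (ind-∧ q r)) ⟩
        ind p * ((ind q * ind r) * (C * S))    ≈⟨ CM.solve 5 (λ p q r C S → p CM.⊕ ((q CM.⊕ r) CM.⊕ (C CM.⊕ S))
                                                                        CM.⊜ (r CM.⊕ S) CM.⊕ (p CM.⊕ (q CM.⊕ C)))
                                                           refl (ind p) (ind q) (ind r) C S ⟩
        (ind r * S) * (ind p * (ind q * C))    ∎

    rowFrom-decomposition : ∀ N la B a (d : Vec ℕ N) → Linked ℕ._≥_ la → length la ≤ N →
                            at la 1 ≤ M → at la 1 ≤ B →
      rowFrom α β M v a d (topBoundary N la) ≈ Σ (map (rowTerm a d la) (lists (length la) B))
    rowFrom-decomposition N [] B a d _ _ _ _ = begin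
      rowFrom α β M v a d (topBoundary N [])  ≈⟨ rowFrom-zeros N a d ⟩
      ind (a ≡ᵇ 0) * δᵛ d (topBoundary N [])  ≈⟨ *-congˡ (sym (*-identityʳ _)) ⟩
      rowTerm a d [] []                        ≈⟨ sym (+-identityʳ _) ⟩
      rowTerm a d [] [] + 0#                   ∎
    rowFrom-decomposition zero (x ∷ la) B a d _ () _ _
    rowFrom-decomposition (suc N) (x ∷ la) B a (d₁ ∷ ds) l la≤N x≤M x≤B = begin
      Σ (map (λ c → W c * rowFrom α β M v c ds (topBoundary N la)) (upTo (suc M)))
        ≈⟨ Σ-cong (upTo (suc M)) (λ c → *-congˡ
             (rowFrom-decomposition N la B c ds (Linked.tail l) (≤-pred la≤N) (≤-trans (head-≥ l) x≤M) (≤-trans (head-≥ l) x≤B))) ⟩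
      Σ (map (λ c → W c * Σ (map (rowTerm c ds la) (lists L B))) (upTo (suc M)))
        ≈⟨ Σ-cong (upTo (suc M)) (λ c → *-Σ (W c) _ (lists L B)) ⟩
      Σ (map (λ c → Σ (map (λ mu → W c * rowTerm c ds la mu) (lists L B))) (upTo (suc M)))
        ≈⟨ Σ-swap (λ c mu → W c * rowTerm c ds la mu) (upTo (suc M)) (lists L B) ⟩
      Σ (map (λ mu → Σ (map (λ c → W c * rowTerm c ds la mu) (upTo (suc M)))) (lists L B))
        ≈⟨ Σ-cong (lists L B) (λ mu → rowTerm-∷ a d₁ ds x la mu B (head-≥ l) x≤M x≤B) ⟩
      Σ (map (λ mu → Σ (map (λ c → rowTerm a (d₁ ∷ ds) (x ∷ la) (c ∷ mu)) (upTo (suc B)))) (lists L B))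
        ≈⟨ sym (Σ-cong (lists L B) (λ mu → Σ-map (rowTerm a (d₁ ∷ ds) (x ∷ la)) (_∷ mu) (upTo (suc B)))) ⟩
      Σ (map (λ mu → Σ (map (rowTerm a (d₁ ∷ ds) (x ∷ la)) (map (_∷ mu) (upTo (suc B))))) (lists L B))
        ≈⟨ sym (Σ-concatMap (rowTerm a (d₁ ∷ ds) (x ∷ la)) (λ mu → map (_∷ mu) (upTo (suc B))) (lists L B)) ⟩
      Σ (map (rowTerm a (d₁ ∷ ds) (x ∷ la)) (lists (suc L) B)) ∎
      where
      L : ℕ
      L = length la
      W : ℕ → Carrier
      W c = w α β v a d₁ c (x ∸ at la 1)

    row-decomposition : ∀ N la B (d : Vec ℕ N) → Linked ℕ._≥_ la → length la ≤ N → at la 1 ≤ M → at la 1 ≤ B →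
      row α β M v d (topBoundary N la) ≈ Σ (map (λ mu → δᵛ d (topBoundary N mu) * stripWeight mu la) (lists (length la) B))
    row-decomposition N la B d l la≤N la₁≤M la₁≤B = begin
      Σ (map (λ a → rowFrom α β M v a d (topBoundary N la)) (upTo (suc M)))
        ≈⟨ Σ-cong (upTo (suc M)) (λ a → rowFrom-decomposition N la B a d l la≤N la₁≤M la₁≤B) ⟩
      Σ (map (λ a → Σ (map (rowTerm a d la) (lists (length la) B))) (upTo (suc M)))
        ≈⟨ Σ-swap (λ a mu → rowTerm a d la mu) (upTo (suc M)) (lists (length la) B) ⟩
      Σ (map (λ mu → Σ (map (λ a → rowTerm a d la mu) (upTo (suc M)))) (lists (length la) B))
        ≈⟨ Σ-cong (lists (length la) B) left-label ⟩
      Σ (map (λ mu → δᵛ d (topBoundary N mu) * stripWeight mu la) (lists (length la) B)) ∎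
      where
      left-label : ∀ mu → Σ (map (λ a → rowTerm a d la mu) (upTo (suc M))) ≈ δᵛ d (topBoundary N mu) * stripWeight mu la
      left-label mu = trans
        (Σ-upTo-single (λ a → rowTerm a d la mu) (s≤s (≤-trans (m∸n≤m (at la 1) (at mu 1)) la₁≤M))
                       (λ a a≢ → ind-false _ (dec-false (a ≟ at la 1 ∸ at mu 1) a≢)))
        (ind-true _ (dec-true (at la 1 ∸ at mu 1 ≟ at la 1 ∸ at mu 1) ≡.refl))

  Z-∷ʳ : ∀ N M {k} (vs : Vec (Carrier × Carrier) k) v bot top → VAll.All (_≤ M) bot → VAll.All (_≤ M) top →
         Z α β N M bot top (vs Vec.∷ʳ v) ≈ Σ (map (λ d → Z α β N M bot d vs * row α β M v d top) (vecs N M))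
  Z-∷ʳ N M [] v bot top bot≤M top≤M = begin
    Σ (map (λ d → row α β M v bot d * δᵛ d top) (vecs N M))
      ≈⟨ Σ-vecs-single _ top≤M (λ d d≢ → trans (*-congˡ (δᵛ-≢ d≢)) (zeroʳ _)) ⟩
    row α β M v bot top * δᵛ top top
      ≈⟨ trans (*-congˡ (δᵛ-refl top)) (*-identityʳ _) ⟩
    row α β M v bot top
      ≈⟨ sym (trans (*-congʳ (δᵛ-refl bot)) (*-identityˡ _)) ⟩
    δᵛ bot bot * row α β M v bot top
      ≈⟨ sym (Σ-vecs-single _ bot≤M (λ d d≢ → trans (*-congʳ (δᵛ-≢ (d≢ ∘ ≡.sym))) (zeroˡ _))) ⟩
    Σ (map (λ d → δᵛ bot d * row α β M v d top) (vecs N M)) ∎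
  Z-∷ʳ N M (u ∷ vs) v bot top bot≤M top≤M = begin
    Σ (map (λ e → row α β M u bot e * Z α β N M e top (vs Vec.∷ʳ v)) (vecs N M))
      ≈⟨ Σ-cong-All (vecs-bounded N M) (λ e≤M → *-congˡ (Z-∷ʳ N M vs v _ top e≤M top≤M)) ⟩
    Σ (map (λ e → row α β M u bot e * Σ (map (λ d → Z α β N M e d vs * row α β M v d top) (vecs N M))) (vecs N M))
      ≈⟨ Σ-cong (vecs N M) (λ e → *-Σ _ _ (vecs N M)) ⟩
    Σ (map (λ e → Σ (map (λ d → row α β M u bot e * (Z α β N M e d vs * row α β M v d top)) (vecs N M))) (vecs N M))
      ≈⟨ Σ-swap (λ e d → row α β M u bot e * (Z α β N M e d vs * row α β M v d top)) (vecs N M) (vecs N M) ⟩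
    Σ (map (λ d → Σ (map (λ e → row α β M u bot e * (Z α β N M e d vs * row α β M v d top)) (vecs N M))) (vecs N M))
      ≈⟨ Σ-cong (vecs N M) (λ d → sym (trans (Σ-* _ _ (vecs N M)) (Σ-cong (vecs N M) (λ e → *-assoc _ _ _)))) ⟩
    Σ (map (λ d → Σ (map (λ e → row α β M u bot e * Z α β N M e d vs) (vecs N M)) * row α β M v d top) (vecs N M)) ∎

  G≈PF : ∀ N M {n} (ws : Vec (Carrier × Carrier) n) la → Linked ℕ._≥_ la → length la ≤ N → at la 1 ≤ M →
         G α β la ws ≈ PF α β N M la ws
  G≈PF N M {zero}  [] la _ la≤N _ = reflexive (≡.cong ind (≡.sym (topBoundary≡0⇔allZero N la la≤N)))
  G≈PF N M {suc n} ws la l la≤N la₁≤M = begin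
    Σ (map gTerm (strips la))
      ≈⟨ Σ-filterᵇ (isHStrip la) gTerm (lists L B) ⟩
    Σ (map (λ mu → ind (isHStrip la mu) * gTerm mu) (lists L B))
      ≈⟨ Σ-cong-All (lists-shape L B) branch ⟩
    Σ (map (λ mu → Z₀ (topBoundary N mu) * stripWeight mu la) (lists L B))
      ≈⟨ Σ-fibres M (topBoundary N) Z₀ (λ mu → stripWeight mu la)
                  (All.map (λ (_ , mu≤B) → topBoundary-bounded N (All.map (λ c≤B → ≤-trans c≤B la₁≤M) mu≤B))
                           (lists-shape L B)) ⟩
    Σ (map (λ d → Z₀ d * Σ (map (λ mu → δᵛ d (topBoundary N mu) * stripWeight mu la) (lists L B))) (vecs N M))
      ≈⟨ Σ-cong (vecs N M) (λ d → *-congˡ (sym (row-decomposition N la B d l la≤N la₁≤M ≤-refl))) ⟩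
    Σ (map (λ d → Z₀ d * row α β M v d (topBoundary N la)) (vecs N M))
      ≈⟨ sym (Z-∷ʳ N M vs v _ _ (zeros-bounded N M) (topBoundary-bounded N (linked-bounded l la₁≤M))) ⟩
    Z α β N M (Vec.replicate N 0) (topBoundary N la) (vs Vec.∷ʳ v)
      ≡⟨ ≡.cong (Z α β N M _ _) (≡.sym (proj₂ (proj₂ (Vec.initLast ws)))) ⟩
    PF α β N M la ws ∎
    where
    vs = Vec.init ws
    v = Vec.last ws
    open Weights v using (stripWeight; hstrip-weight)
    open RowTransfer M v using (row-decomposition)
    L = length la
    B = at la 1
    Z₀ : Vec ℕ N → Carrier
    Z₀ d = Z α β N M (Vec.replicate N 0) d vs
    gTerm : List ℕ → Carrier
    gTerm mu = G α β mu vs * pow (y α β v) (size la ∸ size mu) * pow (z α β v) (rBar mu la)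

    branch : ∀ {mu} → length mu ≡ L × All (_≤ B) mu →
             ind (isHStrip la mu) * gTerm mu ≈ Z₀ (topBoundary N mu) * stripWeight mu la
    branch {mu} (len , _) with isHStrip la mu in strip | hstrip-weight la mu len
    ... | false | weight = trans (zeroˡ _) (sym (trans (*-congˡ (trans (sym weight) (zeroˡ _))) (zeroʳ _)))
    ... | true  | weight = begin
      1# * gTerm mu
        ≈⟨ trans (*-identityˡ _) (*-assoc _ _ _) ⟩
      G α β mu vs * (pow (y α β v) (size la ∸ size mu) * pow (z α β v) (rBar mu la))
        ≈⟨ *-cong (G≈PF N M vs mu (hstrip-linked la mu l len strip) (≤-trans (≤-reflexive len) la≤N)
                                   (≤-trans (hstrip-head la mu len strip) la₁≤M))
                  (trans (sym (*-identityˡ _)) weight) ⟩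
      Z₀ (topBoundary N mu) * stripWeight mu la ∎

-- Neither is the positivity of the parts of λ.
theorem3p1 : ∀ {c ℓ} (R : CommutativeRing c ℓ) → let open CommutativeRing R in
    (α β : Carrier) (n : ℕ) (xs us : Vec Carrier (suc n)) →
    (∀ i → (1# + - (α * lookup xs i)) * lookup us i ≈ 1#) →
    (la : List ℕ) → IsPartition la →
    (N M : ℕ) → length la ≤ N → at la 1 ≤ M →
    Model.G R α β la (zip xs us) ≈ Model.PF R α β N M la (zip xs us)
theorem3p1 R α β n xs us _ la (decreasing , _) N M la≤N la₁≤M =
  Lattice.G≈PF R α β N M (zip xs us) la decreasing la≤N la₁≤M
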